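{- Let $Y$ be a finite chain and let $S=\bigcup_{i\in Y}S_i$ be a semigroup which is the disjoint union of subsemigroups $S_i$ ($i\in Y$) such that for all $i>j$ in $Y$, $s_i\in S_i$ and $s_j\in S_j$ we have $s_is_j=s_j=s_js_i$. If each $S_i$ is $\aleph_0$-categorical, then $S$ is $\aleph_0$-categorical. Moreover, if each $S_i$ is a characteristic subset of $S$ and $S$ is $\aleph_0$-categorical, then each $S_i$ is $\aleph_0$-categorical.
   Context: All semigroups are countable. A countable semigroup $U$ is $\aleph_0$-categorical if for every $n\ge1$ the coordinatewise action of $\operatorname{Aut}(U)$ on $U^n$ has finitely many orbits. A subset $A$ of $S$ is characteristic if $A\phi=A$ for all $\phi\in\operatorname{Aut}(S)$. -}

module Defs where

open import Data.Nat using (ℕ; suc)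
open import Data.Fin using (Fin)
open import Data.Product using (Σ; Σ-syntax; ∃; ∃-syntax; _×_; _,_; proj₁; proj₂)
open import Data.List using (List)
open import Data.List.Relation.Unary.Any using (Any)
open import Function.Definitions using (Injective; Surjective)
open import Relation.Binary.PropositionalEquality using (_≡_; refl; cong; trans)

record Sgp : Set₁ where
  infixl 7 _∙_
  field
    Carrier : Set
    _∙_     : Carrier → Carrier → Carrier
    assoc   : ∀ x y z → (x ∙ y) ∙ z ≡ x ∙ (y ∙ z)

open Sgp public

Countable : Sgp → Set
Countable U = Σ (Carrier U → ℕ) λ f → Injective _≡_ _≡_ f

record Aut (U : Sgp) : Set where
  field
    fun   : Carrier U → Carrier U
    inj   : Injective _≡_ _≡_ fun
    surj  : Surjective _≡_ _≡_ fun
    hom   : ∀ x y → fun (_∙_ U x y) ≡ _∙_ U (fun x) (fun y)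

open Aut public

Tuple : Sgp → ℕ → Set
Tuple U n = Fin n → Carrier U

SameOrbit : (U : Sgp) (n : ℕ) → Tuple U n → Tuple U n → Set
SameOrbit U n t u = ∃[ φ ] (∀ k → fun {U} φ (u k) ≡ t k)

FinitelyManyOrbits : (U : Sgp) (n : ℕ) → Set
FinitelyManyOrbits U n =
  Σ (List (Tuple U n)) λ reps → ∀ (t : Tuple U n) → Any (SameOrbit U n t) reps

ℵ₀-categorical : Sgp → Set
ℵ₀-categorical U = ∀ (n : ℕ) → FinitelyManyOrbits U (suc n)

Characteristic : (S : Sgp) → (Carrier S → Set) → Set
Characteristic S A = ∀ (φ : Aut S) →
  (∀ x → A x → A (fun {S} φ x)) ×
  (∀ y → A y → ∃[ x ] (A x × fun {S} φ x ≡ y))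

Sub : {m : ℕ} (S : Sgp) (ι : Carrier S → Fin m) →
      (∀ x y → ι x ≡ ι y → ι (_∙_ S x y) ≡ ι x) → Fin m → Sgp
Sub {m} S ι closed i = record
  { Carrier = Σ (Carrier S) λ x → ι x ≡ i
  ; _∙_ = λ { (x , px) (y , py) → _∙_ S x y , trans (closed x y (trans px (sym' py))) px }
  ; assoc = λ { (x , px) (y , py) (z , pz) → Σ-≡ (assoc S x y z) }
  }
  where
  sym' : ∀ {a b : Fin m} → a ≡ b → b ≡ a
  sym' refl = refl
  Σ-≡ : ∀ {a b : Carrier S} {pa : ι a ≡ i} {pb : ι b ≡ i} → a ≡ b → (a , pa) ≡ (b , pb)
  Σ-≡ {a} {.a} {pa} {pb} refl = cong (a ,_) (uip pa pb)
    where
    open import Data.Fin.Properties using (_≟_)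
    open import Axiom.UniquenessOfIdentityProofs using (module Decidable⇒UIP)
    uip : (p q : ι a ≡ i) → p ≡ q
    uip = Decidable⇒UIP.≡-irrelevant _≟_

module Submission where

-- Automorphisms ψ_i of the
--     components glue to an automorphism of S (`glue`): the absorption law
--     makes multiplication across components trivial.  Given an n-tuple t of
--     S, pad the coordinates of t lying in S_i to an n-tuple of S_i, move a
--     fixed orbit representative onto it by some ψ_i, and glue.  Hence t lies
--     in the orbit of a tuple whose k-th coordinate is read off from a pair
--     (component, representative); there are finitely many such choices.
-- (2) If S_i is characteristic, every automorphism of S restricts to one of
--     S_i (`restrict`), and any tuple of S in the orbit of a tuple of S_i lies
--     in S_i itself.  So the representatives of S lying in S_i represent all
--     orbits of Aut(S_i).

open import Defs
open import Data.Nat using (ℕ; zero; suc)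
open import Data.Fin using (Fin; _<_; zero; suc)
open import Data.Fin.Properties using (_≟_; any?; all?; <-cmp)
open import Data.Product using (Σ; ∃; _×_; _,_; proj₁; proj₂)
open import Data.List using (List; []; _∷_; map; concatMap; allFin)
open import Data.List.Relation.Unary.Any using (Any; here)
import Data.List.Relation.Unary.Any as Any
open import Data.List.Relation.Unary.Any.Properties using (map⁺; concatMap⁺)
open import Data.List.Membership.Propositional using (_∈_; find)
open import Data.List.Membership.Propositional.Properties using (∈-allFin)
import Data.Vec.Functional as Vector
open import Data.Empty using (⊥-elim)
open import Function using (_∘_)
open import Function.Definitions using (Surjective)
open import Relation.Nullary using (yes; no)
open import Relation.Binary using (tri<; tri≈; tri>)
open import Relation.Binary.PropositionalEquality
  using (_≡_; refl; sym; trans; cong; subst₂; module ≡-Reasoning)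
open import Axiom.UniquenessOfIdentityProofs using (module Decidable⇒UIP)

tuples : {A : Set} → List A → (N : ℕ) → List (Fin N → A)
tuples l zero    = (λ ()) ∷ []
tuples l (suc N) = concatMap (λ a → map (a Vector.∷_) (tuples l N)) l

tuples-complete : {A : Set} (l : List A) (N : ℕ) (x : Fin N → A) →
  (∀ k → x k ∈ l) → Any (λ h → ∀ k → h k ≡ x k) (tuples l N)
tuples-complete l zero    x x∈l = here (λ ())
tuples-complete l (suc N) x x∈l =
  concatMap⁺ _ (Any.map extend (x∈l zero))
  where
  extend : ∀ {a} → x zero ≡ a →
    Any (λ h → ∀ k → h k ≡ x k) (map (a Vector.∷_) (tuples l N))
  extend x₀≡a = map⁺ (Any.map agree (tuples-complete l N (x ∘ suc) (x∈l ∘ suc)))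
    where
    agree : ∀ {h} → (∀ k → h k ≡ x (suc k)) → ∀ k → (_ Vector.∷ h) k ≡ x k
    agree h≗ zero    = sym x₀≡a
    agree h≗ (suc k) = h≗ k

identityAut : (U : Sgp) → Aut U
identityAut U = record
  { fun = λ x → x ; inj = λ e → e ; surj = λ y → y , λ e → e ; hom = λ _ _ → refl }

module Components (S : Sgp) {m : ℕ} (ι : Carrier S → Fin m)
  (closed : ∀ x y → ι x ≡ ι y → ι (_∙_ S x y) ≡ ι x) where

  _·_ : Carrier S → Carrier S → Carrier S
  _·_ = _∙_ S

  Component : Fin m → Sgp
  Component = Sub S ι closed

  component-≡ : ∀ {i} {a b : Carrier (Component i)} → proj₁ a ≡ proj₁ b → a ≡ b
  component-≡ {a = a , p} {.a , q} refl = cong (a ,_) (Decidable⇒UIP.≡-irrelevant _≟_ p q)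

  Absorbing : Set
  Absorbing = ∀ x y → ι y < ι x → (x · y ≡ y) × (y · x ≡ y)

  module Glue (absorb : Absorbing) (ψ : (i : Fin m) → Aut (Component i)) where

    glued : Carrier S → Carrier S
    glued x = proj₁ (fun (ψ (ι x)) (x , refl))

    glued-on : ∀ x i (q : ι x ≡ i) → glued x ≡ proj₁ (fun (ψ i) (x , q))
    glued-on x .(ι x) refl = refl

    glued-ι : ∀ x → ι (glued x) ≡ ι x
    glued-ι x = proj₂ (fun (ψ (ι x)) (x , refl))

    glued-< : ∀ {x y} → ι x < ι y → ι (glued x) < ι (glued y)
    glued-< {x} {y} = subst₂ _<_ (sym (glued-ι x)) (sym (glued-ι y))

    glued-inj : ∀ {x y} → glued x ≡ glued y → x ≡ y
    glued-inj {x} {y} e =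
      cong proj₁ (inj (ψ (ι x)) (component-≡ (trans e (glued-on y (ι x) ιy≡ιx))))
      where
      ιy≡ιx : ι y ≡ ι x
      ιy≡ιx = trans (sym (glued-ι y)) (trans (sym (cong ι e)) (glued-ι x))

    glued-surj : Surjective _≡_ _≡_ glued
    glued-surj y = x , λ z≡x → trans (cong glued z≡x) (trans (glued-on x (ι y) q) ψx≡y)
      where
      preimage : Carrier (Component (ι y))
      preimage = proj₁ (surj (ψ (ι y)) (y , refl))
      x : Carrier S
      x = proj₁ preimage
      q : ι x ≡ ι y
      q = proj₂ preimage
      ψx≡y : proj₁ (fun (ψ (ι y)) (x , q)) ≡ y
      ψx≡y = cong proj₁ (proj₂ (surj (ψ (ι y)) (y , refl)) refl)

    glued-hom-same : ∀ x y → ι y ≡ ι x → glued (x · y) ≡ glued x · glued y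
    glued-hom-same x y q = begin
      glued (x · y)                              ≡⟨ glued-on (x · y) (ι x) (proj₂ xy) ⟩
      proj₁ (fun (ψ (ι x)) xy)                   ≡⟨ cong proj₁ (hom (ψ (ι x)) (x , refl) (y , q)) ⟩
      glued x · proj₁ (fun (ψ (ι x)) (y , q))    ≡⟨ cong (glued x ·_) (sym (glued-on y (ι x) q)) ⟩
      glued x · glued y                          ∎
      where
      open ≡-Reasoning
      xy : Carrier (Component (ι x))
      xy = _∙_ (Component (ι x)) (x , refl) (y , q)

    glued-hom : ∀ x y → glued (x · y) ≡ glued x · glued y
    glued-hom x y with <-cmp (ι x) (ι y)
    ... | tri< x<y _ _ =
      trans (cong glued (proj₂ (absorb y x x<y)))
            (sym (proj₂ (absorb (glued y) (glued x) (glued-< x<y))))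
    ... | tri≈ _ x≡y _ = glued-hom-same x y (sym x≡y)
    ... | tri> _ _ y<x =
      trans (cong glued (proj₁ (absorb x y y<x)))
            (sym (proj₁ (absorb (glued x) (glued y) (glued-< y<x))))

    glue : Aut S
    glue = record { fun = glued ; inj = glued-inj ; surj = glued-surj ; hom = glued-hom }

  module Union (absorb : Absorbing) (cat : ∀ i → ℵ₀-categorical (Component i)) (n : ℕ) where

    N : ℕ
    N = suc n

    orbitReps : (i : Fin m) → List (Tuple (Component i) N)
    orbitReps i = proj₁ (cat i n)

    Code : Set
    Code = Σ (Fin m) λ i → Tuple (Component i) N

    codes : List Code
    codes = concatMap (λ i → map (i ,_) (orbitReps i)) (allFin m)

    code∈codes : ∀ i {ρ} → ρ ∈ orbitReps i → (i , ρ) ∈ codes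
    code∈codes i ρ∈ = concatMap⁺ _ (Any.map (λ { refl → map⁺ (Any.map (cong (i ,_)) ρ∈) }) (∈-allFin i))

    -- One code per coordinate; coordinate k is the k-th entry of its code.
    decode : (Fin N → Code) → Tuple S N
    decode c k = proj₁ (proj₂ (c k) k)

    reps : List (Tuple S N)
    reps = map decode (tuples codes N)

    module Cover (t : Tuple S N) where

      Occurs : Fin m → Set
      Occurs i = ∃ λ k → ι (t k) ≡ i

      pad : ∀ i → Occurs i → Tuple (Component i) N
      pad i (k₀ , q₀) k with ι (t k) ≟ i
      ... | yes q = t k , q
      ... | no _  = t k₀ , q₀

      pad-agrees : ∀ i w k → ι (t k) ≡ i → proj₁ (pad i w k) ≡ t k
      pad-agrees i w k q with ι (t k) ≟ i
      ... | yes _ = refl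
      ... | no q̸ = ⊥-elim (q̸ q)

      Matches : (i : Fin m) → Aut (Component i) → Set
      Matches i ψ = ∃ λ ρ → ρ ∈ orbitReps i × (∀ k (q : ι (t k) ≡ i) → proj₁ (fun ψ (ρ k)) ≡ t k)

      matching : ∀ i → Occurs i → Σ (Aut (Component i)) (Matches i)
      matching i w with find (proj₂ (cat i n) (pad i w))
      ... | ρ , ρ∈ , ψ , ψρ≡pad =
        ψ , ρ , ρ∈ , λ k q → trans (cong proj₁ (ψρ≡pad k)) (pad-agrees i w k q)

      local : ∀ i → Σ (Aut (Component i)) λ ψ → Occurs i → Matches i ψ
      local i with any? (λ k → ι (t k) ≟ i)
      ... | yes w = proj₁ (matching i w) , λ _ → proj₂ (matching i w)
      ... | no w̸  = identityAut (Component i) , λ w → ⊥-elim (w̸ w)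

      φ : Aut S
      φ = Glue.glue absorb (proj₁ ∘ local)

      match : ∀ k → Matches (ι (t k)) (proj₁ (local (ι (t k))))
      match k = proj₂ (local (ι (t k))) (k , refl)

      code : Fin N → Code
      code k = ι (t k) , proj₁ (match k)

      φ-decode : ∀ k → fun φ (decode code k) ≡ t k
      φ-decode k = trans (Glue.glued-on absorb (proj₁ ∘ local) _ (ι (t k)) (proj₂ (ρ k)))
                         (proj₂ (proj₂ (match k)) k refl)
        where
        ρ : Tuple (Component (ι (t k))) N
        ρ = proj₁ (match k)

      covered : Any (SameOrbit S N t) reps
      covered = map⁺ (Any.map inOrbit (tuples-complete codes N code
                  (λ k → code∈codes (ι (t k)) (proj₁ (proj₂ (match k))))))
        where
        inOrbit : ∀ {c} → (∀ k → c k ≡ code k) → SameOrbit S N t (decode c)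
        inOrbit c≗code = φ , λ k →
          trans (cong (λ d → fun φ (proj₁ (proj₂ d k))) (c≗code k)) (φ-decode k)

  unionCategorical : Absorbing → (∀ i → ℵ₀-categorical (Component i)) → ℵ₀-categorical S
  unionCategorical absorb cat n = Union.reps absorb cat n , Union.Cover.covered absorb cat n

  module _ (i : Fin m) (ch : Characteristic S (λ x → ι x ≡ i)) where

    restrict : Aut S → Aut (Component i)
    restrict φ = record
      { fun  = f
      ; inj  = λ e → component-≡ (inj φ (cong proj₁ e))
      ; surj = f-surj
      ; hom  = λ x y → component-≡ (hom φ (proj₁ x) (proj₁ y))
      }
      where
      f : Carrier (Component i) → Carrier (Component i)
      f (x , q) = fun φ x , proj₁ (ch φ) x q
      f-surj : Surjective _≡_ _≡_ f
      f-surj (y , q) with proj₂ (ch φ) y q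
      ... | x , qx , φx≡y = (x , qx) , λ z≡x → component-≡ (trans (cong (fun φ ∘ proj₁) z≡x) φx≡y)

    preimage-in-component : (φ : Aut S) → ∀ {r t} → fun φ r ≡ t → ι t ≡ i → ι r ≡ i
    preimage-in-component φ {t = t} φr≡t qt with proj₂ (ch φ) t qt
    ... | x , qx , φx≡t = trans (cong ι (inj φ (trans φr≡t (sym φx≡t)))) qx

    componentCategorical : ℵ₀-categorical S → ℵ₀-categorical (Component i)
    componentCategorical cat n = concatMap inComponent (proj₁ (cat n)) , covered
      where
      inComponent : Tuple S (suc n) → List (Tuple (Component i) (suc n))
      inComponent r with all? (λ k → ι (r k) ≟ i)
      ... | yes r∈ = (λ k → r k , r∈ k) ∷ []
      ... | no _   = []

      inComponent-covers : ∀ u r → SameOrbit S (suc n) (proj₁ ∘ u) r →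
        Any (SameOrbit (Component i) (suc n) u) (inComponent r)
      inComponent-covers u r (φ , φr≡u) with all? (λ k → ι (r k) ≟ i)
      ... | yes _  = here (restrict φ , λ k → component-≡ (φr≡u k))
      ... | no r∉ = ⊥-elim (r∉ λ k → preimage-in-component φ (φr≡u k) (proj₂ (u k)))

      covered : ∀ u → Any (SameOrbit (Component i) (suc n) u) (concatMap inComponent (proj₁ (cat n)))
      covered u = concatMap⁺ _ (Any.map (inComponent-covers u _) (proj₂ (cat n) (proj₁ ∘ u)))

proposition2p20 : (S : Sgp) → Countable S → (m : ℕ) (ι : Carrier S → Fin m)
    → (closed : ∀ x y → ι x ≡ ι y → ι (_∙_ S x y) ≡ ι x)
    → (∀ x y → ι y < ι x → (_∙_ S x y ≡ y) × (_∙_ S y x ≡ y))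
    → ((∀ i → ℵ₀-categorical (Sub S ι closed i)) → ℵ₀-categorical S)
    × ((∀ i → Characteristic S (λ x → ι x ≡ i)) → ℵ₀-categorical S
    → ∀ i → ℵ₀-categorical (Sub S ι closed i))
proposition2p20 S _ m ι closed absorb =
  unionCategorical absorb , λ ch cat i → componentCategorical i (ch i) cat
  where open Components S ι closed
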